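{- If $n>1$ is an integer, then $pc(n,m)$ is even for every integer $m\geq 1$.
   Context: A composition of a positive integer $n$ of length $k$ is a sequence $\sigma=(\sigma_1,\ldots,\sigma_k)$ of positive integers with $\sum_i \sigma_i=n$. For an integer $m\geq 1$, $\sigma$ is palindromic modulo $m$ if $\sigma_i\equiv\sigma_{k-i+1}\pmod m$ for all $1\le i\le k$. $pc(n,m)$ denotes the number of compositions of $n$ that are palindromic modulo $m$. -}

module Defs where

open import Data.Nat using (ℕ; zero; suc; _+_; _∸_; _<_; _%_; NonZero)
open import Data.Nat.Properties using (_≟_)
open import Data.List using (List; []; _∷_; length; filter; map; concatMap; upTo; lookup)
open import Data.Nat.ListAction using (sum)
open import Data.List.Relation.Unary.All using (All)
open import Data.List.Relation.Unary.All as All using ()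
open import Data.Fin using (Fin; toℕ; opposite)
open import Data.Fin.Properties using (all?)
open import Relation.Binary.PropositionalEquality using (_≡_)
open import Relation.Nullary using (Dec; yes; no)
open import Relation.Nullary.Decidable using (_×-dec_)
open import Data.Product using (_×_)

listsOf : ℕ → ℕ → List (List ℕ)
listsOf n zero = [] ∷ []
listsOf n (suc k) = concatMap (λ a → map (a ∷_) (listsOf n k)) (map suc (upTo n))

-- All lists of length at most n with entries in {1, …, n}
-- (every composition of n lies in this finite set).
candidates : ℕ → List (List ℕ)
candidates n = concatMap (listsOf n) (upTo (suc n))

IsComposition : ℕ → List ℕ → Set
IsComposition n σ = All (λ a → 0 < a) σ × sum σ ≡ n

isComposition? : (n : ℕ) (σ : List ℕ) → Dec (IsComposition n σ)
isComposition? n σ = All.all? (λ a → Data.Nat._<?_ 0 a) σ ×-dec (sum σ ≟ n)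

compositions : ℕ → List (List ℕ)
compositions n = filter (isComposition? n) (candidates n)

-- σ is palindromic modulo m: σ_i ≡ σ_{k-i+1} (mod m) for all i (0-indexed: i ↦ k-1-i).
mirror : ∀ {k} → Fin k → Fin k
mirror = opposite

PalindromicMod : (m : ℕ) .{{_ : NonZero m}} → List ℕ → Set
PalindromicMod m σ = ∀ (i : Fin (length σ)) → lookup σ i % m ≡ lookup σ (mirror i) % m

palindromicMod? : (m : ℕ) .{{_ : NonZero m}} (σ : List ℕ) → Dec (PalindromicMod m σ)
palindromicMod? m σ = all? (λ i → (lookup σ i % m) ≟ (lookup σ (mirror i) % m))

pc : (n m : ℕ) .{{_ : NonZero m}} → ℕ
pc n m = length (filter (palindromicMod? m) (compositions n))

-- A fixed-point-free involution on a finite set forces its size to be even.  On the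
-- compositions counted by pc(n, m), take reversal on the non-palindromes (it preserves being
-- palindromic modulo m) and, on the palindromes of n ≥ 3, toggling both ends, where toggling
-- an end splits a part 1 off the end part or merges an end part 1 into its neighbour.
-- For n = 2 both compositions, 2 and 1 + 1, are palindromes.

module Submission where

open import Defs
open import Level using (Level; _⊔_)
open import Function using (_on_; _∘_)
open import Data.Nat using (ℕ; zero; suc; _+_; _<_; _≤_; s≤s; z≤n; _%_; NonZero)
open import Data.Nat.Properties
  using (_≟_; suc-injective; +-identityʳ; +-suc; m∸n+n≡m; ≤-refl; ≤-trans; m≤m+n; m≤n+m)
open import Data.Nat.Divisibility using (_∣_; _∣0; ∣-refl; ∣-reflexive; ∣m∣n⇒∣m+n)
open import Data.Nat.ListAction using (sum)
open import Data.Nat.ListAction.Properties using (sum-↭)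
open import Data.Fin using (Fin; toℕ; opposite; zero; suc)
open import Data.Fin.Properties using (toℕ-injective; toℕ<n; opposite-prop; toℕ-cast)
open import Data.Product using (_×_; _,_; proj₁; proj₂)
open import Data.List
  using (List; []; _∷_; _++_; length; map; concatMap; upTo; filter; reverse; reverseAcc; lookup)
open import Data.List.Properties
  using ( ≡-dec; ∷-injectiveʳ; length-removeAt′; length-reverse; reverse-++; reverse-involutive
        ; filter-all)
open import Data.List.Membership.Propositional using (_∈_; _∉_; lose)
open import Data.List.Membership.Propositional.Properties
  using (∈-concatMap⁺; ∈-concatMap⁻; ∈-map⁺; ∈-upTo⁺; ∈-filter⁺; ∈-filter⁻; map∷⁻; map∷-decomp∈)
open import Data.List.Relation.Unary.Any as Any using (here; there; _─_; index)
open import Data.List.Relation.Unary.All as All using (All; []; _∷_)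
import Data.List.Relation.Unary.All.Properties as All
open import Data.List.Relation.Unary.AllPairs as AllPairs using ([]; _∷_)
import Data.List.Relation.Unary.AllPairs.Properties as AllPairs
open import Data.List.Relation.Unary.Unique.Propositional using (Unique)
import Data.List.Relation.Unary.Unique.Propositional.Properties as Unique
open import Data.List.Relation.Binary.Disjoint.Propositional using (Disjoint)
open import Data.List.Relation.Binary.Pointwise as Pointwise using (Pointwise)
open import Data.List.Relation.Binary.Permutation.Propositional using (↭-sym)
open import Data.List.Relation.Binary.Permutation.Propositional.Properties
  using (↭-reverse; All-resp-↭)
open import Relation.Binary.PropositionalEquality
  using (_≡_; _≢_; refl; sym; trans; cong; subst; module ≡-Reasoning)
open import Relation.Nullary using (¬_; yes; no; contradiction)
open import Relation.Unary using (Pred; Decidable; _∩_; ∁; _≐_)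

private
  variable
    a b p ℓ : Level
    A : Set a
    B : Set b

∈-─⁻ : ∀ {x y : A} {xs} (x∈xs : x ∈ xs) → y ∈ (xs ─ x∈xs) → y ∈ xs
∈-─⁻ (here _)     y∈        = there y∈
∈-─⁻ (there x∈xs) (here y≡) = here y≡
∈-─⁻ (there x∈xs) (there y∈) = there (∈-─⁻ x∈xs y∈)

∈-─⁺ : ∀ {x y : A} {xs} (x∈xs : x ∈ xs) → y ∈ xs → y ≢ x → y ∈ (xs ─ x∈xs)
∈-─⁺ (here refl)  (here refl) y≢x = contradiction refl y≢x
∈-─⁺ (here _)     (there y∈)  _   = y∈
∈-─⁺ (there x∈xs) (here y≡)   _   = here y≡
∈-─⁺ (there x∈xs) (there y∈)  y≢x = there (∈-─⁺ x∈xs y∈ y≢x)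

unique-─ : ∀ {x : A} {xs} (x∈xs : x ∈ xs) → Unique xs → Unique (xs ─ x∈xs)
unique-─ (here _)     (_ ∷ u)  = u
unique-─ (there x∈xs) (y∉ ∷ u) =
  All.tabulate (All.lookup y∉ ∘ ∈-─⁻ x∈xs) ∷ unique-─ x∈xs u

∉-─ : ∀ {x : A} {xs} (x∈xs : x ∈ xs) → Unique xs → x ∉ (xs ─ x∈xs)
∉-─ (here refl)  (x∉ ∷ _) x∈          = All.lookup x∉ x∈ refl
∉-─ (there x∈xs) (y∉ ∷ _) (here refl) = All.lookup y∉ x∈xs refl
∉-─ (there x∈xs) (_ ∷ u)  (there x∈)  = ∉-─ x∈xs u x∈

length-─ : ∀ {x : A} {xs} (x∈xs : x ∈ xs) → length xs ≡ suc (length (xs ─ x∈xs))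
length-─ {xs = xs} x∈xs = length-removeAt′ xs (index x∈xs)

concatMap-unique : ∀ (g : A → List B) {xs} → Unique xs → (∀ x → Unique (g x)) →
                   (∀ {x y} → x ≢ y → Disjoint (g x) (g y)) → Unique (concatMap g xs)
concatMap-unique g u ug dg =
  Unique.concat⁺ (All.map⁺ (All.universal ug _)) (AllPairs.map⁺ (AllPairs.map dg u))

record FixedPointFreeInvolutionOn {a ℓ} {A : Set a} (S : Pred A ℓ) (f : A → A) : Set (a ⊔ ℓ) where
  field
    closed         : ∀ {x} → S x → S (f x)
    involutive     : ∀ {x} → S x → f (f x) ≡ x
    fixedPointFree : ∀ {x} → S x → f x ≢ x

  injective : ∀ {x y} → S x → S y → f x ≡ f y → x ≡ y
  injective sx sy fx≡fy = trans (sym (involutive sx)) (trans (cong f fx≡fy) (involutive sy))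

module _ {f : A → A} where
  open FixedPointFreeInvolutionOn

  FixedPointFreeInvolutionOn-resp-≐ : ∀ {ℓ′} {S : Pred A ℓ} {T : Pred A ℓ′} →
    S ≐ T → FixedPointFreeInvolutionOn S f → FixedPointFreeInvolutionOn T f
  FixedPointFreeInvolutionOn-resp-≐ (S⊆T , T⊆S) ι = record
    { closed         = S⊆T ∘ closed ι ∘ T⊆S
    ; involutive     = involutive ι ∘ T⊆S
    ; fixedPointFree = fixedPointFree ι ∘ T⊆S
    }

  partner∈tail : ∀ {x xs} → FixedPointFreeInvolutionOn (_∈ x ∷ xs) f → f x ∈ xs
  partner∈tail ι with closed ι (here refl)
  ... | here  fx≡x  = contradiction fx≡x (fixedPointFree ι (here refl))
  ... | there fx∈xs = fx∈xs

  without-pair : ∀ {x xs} → Unique (x ∷ xs) → (ι : FixedPointFreeInvolutionOn (_∈ x ∷ xs) f) →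
                 FixedPointFreeInvolutionOn (_∈ (xs ─ partner∈tail ι)) f
  without-pair {x} {xs} (x∉xs ∷ u) ι = record
    { closed         = closed′
    ; involutive     = involutive ι ∘ ⊆x∷xs
    ; fixedPointFree = fixedPointFree ι ∘ ⊆x∷xs
    }
    where
    fx∈xs = partner∈tail ι
    ⊆x∷xs : ∀ {y} → y ∈ (xs ─ fx∈xs) → y ∈ x ∷ xs
    ⊆x∷xs = there ∘ ∈-─⁻ fx∈xs
    closed′ : ∀ {y} → y ∈ (xs ─ fx∈xs) → f y ∈ (xs ─ fx∈xs)
    closed′ {y} y∈ with closed ι (⊆x∷xs y∈)
    ... | here fy≡x =
      contradiction (subst (_∈ (xs ─ fx∈xs)) y≡fx y∈) (∉-─ fx∈xs u)
      where
      y≡fx : y ≡ f x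
      y≡fx = injective ι (⊆x∷xs y∈) (closed ι (here refl))
                          (trans fy≡x (sym (involutive ι (here refl))))
    ... | there fy∈xs = ∈-─⁺ fx∈xs fy∈xs λ fy≡fx →
      All.lookup x∉xs (∈-─⁻ fx∈xs y∈) (injective ι (here refl) (⊆x∷xs y∈) (sym fy≡fx))

  2∣length : ∀ {xs} → Unique xs → FixedPointFreeInvolutionOn (_∈ xs) f → 2 ∣ length xs
  2∣length = go _ refl
    where
    go : ∀ n {xs} → length xs ≡ n → Unique xs → FixedPointFreeInvolutionOn (_∈ xs) f → 2 ∣ n
    go zero          {[]}     _    _ _ = 2 ∣0
    go (suc zero)    {_ ∷ []} _    _ ι with () ← partner∈tail ι
    go (suc (suc n)) {_ ∷ xs} |xs| u ι =
      ∣m∣n⇒∣m+n ∣-refl (go n |xs─fx| (unique-─ fx∈xs (AllPairs.tail u)) (without-pair u ι))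
      where
      fx∈xs = partner∈tail ι
      |xs─fx| : length (xs ─ fx∈xs) ≡ n
      |xs─fx| = suc-injective (trans (sym (length-─ fx∈xs)) (suc-injective |xs|))

module _ {P : Pred A p} (P? : Decidable P) (f g : A → A) where
  open FixedPointFreeInvolutionOn

  piecewise : A → A
  piecewise x with P? x
  ... | yes _ = f x
  ... | no  _ = g x

  piecewise-yes : ∀ {x} → P x → piecewise x ≡ f x
  piecewise-yes {x} px with P? x
  ... | yes _   = refl
  ... | no  ¬px = contradiction px ¬px

  piecewise-no : ∀ {x} → ¬ P x → piecewise x ≡ g x
  piecewise-no {x} ¬px with P? x
  ... | yes px = contradiction px ¬px
  ... | no  _  = refl

  piecewise-fixedPointFreeInvolution : ∀ {S : Pred A ℓ} →
    FixedPointFreeInvolutionOn (S ∩ P) f → FixedPointFreeInvolutionOn (S ∩ ∁ P) g →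
    FixedPointFreeInvolutionOn S piecewise
  piecewise-fixedPointFreeInvolution {S = S} ιf ιg = record
    { closed         = closed′
    ; involutive     = involutive′
    ; fixedPointFree = fixedPointFree′
    }
    where
    closed′ : ∀ {x} → S x → S (piecewise x)
    closed′ {x} sx with P? x
    ... | yes px  = proj₁ (closed ιf (sx , px))
    ... | no  ¬px = proj₁ (closed ιg (sx , ¬px))
    involutive′ : ∀ {x} → S x → piecewise (piecewise x) ≡ x
    involutive′ {x} sx with P? x
    ... | yes px  = trans (piecewise-yes (proj₂ (closed ιf (sx , px)))) (involutive ιf (sx , px))
    ... | no  ¬px = trans (piecewise-no (proj₂ (closed ιg (sx , ¬px)))) (involutive ιg (sx , ¬px))
    fixedPointFree′ : ∀ {x} → S x → piecewise x ≢ x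
    fixedPointFree′ {x} sx with P? x
    ... | yes px  = fixedPointFree ιf (sx , px)
    ... | no  ¬px = fixedPointFree ιg (sx , ¬px)

Palindrome : List ℕ → Set
Palindrome σ = σ ≡ reverse σ

palindrome? : Decidable Palindrome
palindrome? σ = ≡-dec _≟_ σ (reverse σ)

toℕ-opposite+suc : ∀ {n} (i : Fin n) → toℕ (opposite i) + suc (toℕ i) ≡ n
toℕ-opposite+suc i = trans (cong (_+ suc (toℕ i)) (opposite-prop i)) (m∸n+n≡m (toℕ<n i))

lookup-reverseAcc-acc : ∀ (acc xs : List A) (i : Fin (length (reverseAcc acc xs)))
                        (k : Fin (length acc)) →
                        toℕ i ≡ toℕ k + length xs → lookup (reverseAcc acc xs) i ≡ lookup acc k
lookup-reverseAcc-acc acc []       i k i≡k+0 =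
  cong (lookup acc) (toℕ-injective (trans i≡k+0 (+-identityʳ (toℕ k))))
lookup-reverseAcc-acc acc (x ∷ xs) i k i≡k+ =
  lookup-reverseAcc-acc (x ∷ acc) xs i (suc k) (trans i≡k+ (+-suc (toℕ k) (length xs)))

lookup-reverseAcc : ∀ (acc xs : List A) (i : Fin (length (reverseAcc acc xs)))
                    (j : Fin (length xs)) →
                    toℕ j + suc (toℕ i) ≡ length xs → lookup (reverseAcc acc xs) i ≡ lookup xs j
lookup-reverseAcc acc (x ∷ xs) i zero    j+i+1≡ =
  lookup-reverseAcc-acc (x ∷ acc) xs i zero (suc-injective j+i+1≡)
lookup-reverseAcc acc (x ∷ xs) i (suc j) j+i+1≡ =
  lookup-reverseAcc (x ∷ acc) xs i j (suc-injective j+i+1≡)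

lookup-reverse : ∀ (xs : List A) (i : Fin (length xs)) (j : Fin (length (reverse xs))) →
                 toℕ i ≡ toℕ j → lookup (reverse xs) j ≡ lookup xs (opposite i)
lookup-reverse xs i j i≡j = lookup-reverseAcc [] xs j (opposite i)
  (subst (λ t → toℕ (opposite i) + suc t ≡ length xs) i≡j (toℕ-opposite+suc i))

module _ (m : ℕ) .{{_ : NonZero m}} where

  PalindromicMod⇒Pointwise : ∀ {σ} → PalindromicMod m σ → Pointwise (_≡_ on (_% m)) σ (reverse σ)
  PalindromicMod⇒Pointwise {σ} pal = Pointwise.lookup⁻ (sym (length-reverse σ))
    λ {i} i≡j → trans (pal i) (cong (_% m) (sym (lookup-reverse σ i _ i≡j)))

  Pointwise⇒PalindromicMod : ∀ {σ} → Pointwise (_≡_ on (_% m)) σ (reverse σ) → PalindromicMod m σ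
  Pointwise⇒PalindromicMod {σ} pw i = trans (Pointwise.lookup⁺ pw i)
    (cong (_% m) (lookup-reverse σ i _ (sym (toℕ-cast _ i))))

  PalindromicMod-reverse : ∀ {σ} → PalindromicMod m σ → PalindromicMod m (reverse σ)
  PalindromicMod-reverse {σ} =
    Pointwise⇒PalindromicMod {reverse σ} ∘ Pointwise.reverse⁺ ∘ PalindromicMod⇒Pointwise {σ}

  palindrome⇒PalindromicMod : ∀ {σ} → Palindrome σ → PalindromicMod m σ
  palindrome⇒PalindromicMod {σ} σ≡rσ =
    Pointwise⇒PalindromicMod (subst (Pointwise _ σ) σ≡rσ (Pointwise.refl refl))

length-listsOf : ∀ n k {σ} → σ ∈ listsOf n k → length σ ≡ k
length-listsOf n zero    (here refl) = refl
length-listsOf n (suc k) σ∈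
  with _ , σ∈a∷ ← Any.satisfied (∈-concatMap⁻ _ {xs = map suc (upTo n)} σ∈)
  with _ , τ∈ , refl ← map∷⁻ σ∈a∷ = cong suc (length-listsOf n k τ∈)

listsOf-unique : ∀ n k → Unique (listsOf n k)
listsOf-unique n zero    = [] ∷ []
listsOf-unique n (suc k) = concatMap-unique _ (Unique.map⁺ suc-injective (Unique.upTo⁺ n))
  (λ _ → Unique.map⁺ ∷-injectiveʳ (listsOf-unique n k)) heads-differ
  where
  heads-differ : ∀ {a b} → a ≢ b → Disjoint (map (a ∷_) (listsOf n k)) (map (b ∷_) (listsOf n k))
  heads-differ a≢b (σ∈a∷ , σ∈b∷) with _ , _ , refl ← map∷⁻ σ∈a∷ =
    a≢b (proj₁ (map∷-decomp∈ σ∈b∷))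

candidates-unique : ∀ n → Unique (candidates n)
candidates-unique n = concatMap-unique (listsOf n) (Unique.upTo⁺ (suc n)) (listsOf-unique n)
  λ k≢l (σ∈k , σ∈l) → k≢l (trans (sym (length-listsOf n _ σ∈k)) (length-listsOf n _ σ∈l))

compositions-unique : ∀ n → Unique (compositions n)
compositions-unique n = Unique.filter⁺ (isComposition? n) (candidates-unique n)

∈-listsOf : ∀ n {σ} → All (λ a → 0 < a × a ≤ n) σ → σ ∈ listsOf n (length σ)
∈-listsOf n {[]}        []                = here refl
∈-listsOf n {suc a ∷ σ} ((_ , a<n) ∷ as) =
  ∈-concatMap⁺ _ (lose (∈-map⁺ suc (∈-upTo⁺ a<n)) (∈-map⁺ (suc a ∷_) (∈-listsOf n as)))

entries≤sum : ∀ σ → All (_≤ sum σ) σ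
entries≤sum []      = []
entries≤sum (a ∷ σ) =
  m≤m+n a (sum σ) ∷ All.map (λ b≤ → ≤-trans b≤ (m≤n+m (sum σ) a)) (entries≤sum σ)

length≤sum : ∀ {σ} → All (0 <_) σ → length σ ≤ sum σ
length≤sum {[]}        []       = z≤n
length≤sum {suc a ∷ σ} (_ ∷ as) = s≤s (≤-trans (length≤sum as) (m≤n+m (sum σ) a))

∈-compositions : ∀ {n σ} → IsComposition n σ → σ ∈ compositions n
∈-compositions {σ = σ} c@(pos , refl) = ∈-filter⁺ (isComposition? _) σ∈candidates c
  where
  σ∈candidates : σ ∈ candidates (sum σ)
  σ∈candidates = ∈-concatMap⁺ (listsOf _)
    (lose (∈-upTo⁺ (s≤s (length≤sum pos))) (∈-listsOf _ (All.zip (pos , entries≤sum σ))))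

toggleHead : List ℕ → List ℕ
toggleHead []                = []
toggleHead (zero ∷ σ)        = zero ∷ σ
toggleHead (1 ∷ [])          = 1 ∷ []
toggleHead (1 ∷ b ∷ σ)       = suc b ∷ σ
toggleHead (suc (suc a) ∷ σ) = 1 ∷ suc a ∷ σ

toggleLast : List ℕ → List ℕ
toggleLast σ = reverse (toggleHead (reverse σ))

toggleEnds : List ℕ → List ℕ
toggleEnds σ = toggleLast (toggleHead σ)

reverse-isComposition : ∀ {n σ} → IsComposition n σ → IsComposition n (reverse σ)
reverse-isComposition {σ = σ} (pos , sum≡n) =
  All-resp-↭ (↭-sym (↭-reverse σ)) pos , trans (sum-↭ (↭-reverse σ)) sum≡n

toggleHead-isComposition : ∀ {n σ} → IsComposition n σ → IsComposition n (toggleHead σ)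
toggleHead-isComposition {σ = []}              c                 = c
toggleHead-isComposition {σ = zero ∷ _}        c                 = c
toggleHead-isComposition {σ = 1 ∷ []}          c                 = c
toggleHead-isComposition {σ = 1 ∷ _ ∷ _}       (_ ∷ _ ∷ pos , s) = s≤s z≤n ∷ pos , s
toggleHead-isComposition {σ = suc (suc _) ∷ _} (_ ∷ pos , s)     = s≤s z≤n ∷ s≤s z≤n ∷ pos , s

toggleLast-isComposition : ∀ {n σ} → IsComposition n σ → IsComposition n (toggleLast σ)
toggleLast-isComposition = reverse-isComposition ∘ toggleHead-isComposition ∘ reverse-isComposition

toggleHead-involutive : ∀ {σ} → All (0 <_) σ → toggleHead (toggleHead σ) ≡ σ
toggleHead-involutive {[]}              _            = refl
toggleHead-involutive {zero ∷ _}        _            = refl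
toggleHead-involutive {1 ∷ []}          _            = refl
toggleHead-involutive {1 ∷ suc _ ∷ _}   _            = refl
toggleHead-involutive {suc (suc _) ∷ _} _            = refl
toggleHead-involutive {1 ∷ zero ∷ _}    (_ ∷ () ∷ _)

toggleLast-involutive : ∀ {σ} → All (0 <_) σ → toggleLast (toggleLast σ) ≡ σ
toggleLast-involutive {σ} pos = begin
  reverse (toggleHead (reverse (reverse (toggleHead (reverse σ)))))
    ≡⟨ cong (reverse ∘ toggleHead) (reverse-involutive (toggleHead (reverse σ))) ⟩
  reverse (toggleHead (toggleHead (reverse σ)))
    ≡⟨ cong reverse (toggleHead-involutive (All-resp-↭ (↭-sym (↭-reverse σ)) pos)) ⟩
  reverse (reverse σ)
    ≡⟨ reverse-involutive σ ⟩
  σ ∎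
  where open ≡-Reasoning

toggleHead-++ : ∀ σ τ → 2 ≤ length σ → toggleHead (σ ++ τ) ≡ toggleHead σ ++ τ
toggleHead-++ (zero        ∷ _ ∷ _) _ _        = refl
toggleHead-++ (1           ∷ _ ∷ _) _ _        = refl
toggleHead-++ (suc (suc _) ∷ _ ∷ _) _ _        = refl
toggleHead-++ (_ ∷ [])              _ (s≤s ())

toggleLast-++ : ∀ σ τ → 2 ≤ length τ → toggleLast (σ ++ τ) ≡ σ ++ toggleLast τ
toggleLast-++ σ τ 2≤|τ| = begin
  reverse (toggleHead (reverse (σ ++ τ)))
    ≡⟨ cong (reverse ∘ toggleHead) (reverse-++ σ τ) ⟩
  reverse (toggleHead (reverse τ ++ reverse σ))
    ≡⟨ cong reverse (toggleHead-++ (reverse τ) (reverse σ) 2≤|rτ|) ⟩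
  reverse (toggleHead (reverse τ) ++ reverse σ)
    ≡⟨ reverse-++ (toggleHead (reverse τ)) (reverse σ) ⟩
  reverse (reverse σ) ++ toggleLast τ
    ≡⟨ cong (_++ toggleLast τ) (reverse-involutive σ) ⟩
  σ ++ toggleLast τ ∎
  where
  open ≡-Reasoning
  2≤|rτ| = subst (2 ≤_) (sym (length-reverse τ)) 2≤|τ|

toggleHead∘toggleLast-apart : ∀ a b τ → 2 ≤ length τ →
  toggleHead (toggleLast (a ∷ b ∷ τ)) ≡ toggleHead (a ∷ b ∷ []) ++ toggleLast τ
toggleHead∘toggleLast-apart a b τ 2≤|τ| =
  trans (cong toggleHead (toggleLast-++ (a ∷ b ∷ []) τ 2≤|τ|))
        (toggleHead-++ (a ∷ b ∷ []) (toggleLast τ) ≤-refl)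

toggleEnds-apart : ∀ a b τ → 2 ≤ length τ →
  toggleEnds (a ∷ b ∷ τ) ≡ toggleHead (a ∷ b ∷ []) ++ toggleLast τ
toggleEnds-apart a b τ 2≤|τ| =
  trans (cong toggleLast (toggleHead-++ (a ∷ b ∷ []) τ ≤-refl))
        (toggleLast-++ (toggleHead (a ∷ b ∷ [])) τ 2≤|τ|)

toggleHead∘toggleLast≡toggleEnds : ∀ σ → toggleHead (toggleLast σ) ≡ toggleEnds σ
toggleHead∘toggleLast≡toggleEnds (a ∷ b ∷ c ∷ d ∷ τ) =
  trans (toggleHead∘toggleLast-apart a b (c ∷ d ∷ τ) (s≤s (s≤s z≤n)))
        (sym (toggleEnds-apart a b (c ∷ d ∷ τ) (s≤s (s≤s z≤n))))
toggleHead∘toggleLast≡toggleEnds []                                       = refl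
toggleHead∘toggleLast≡toggleEnds (zero ∷ [])                              = refl
toggleHead∘toggleLast≡toggleEnds (1 ∷ [])                                 = refl
toggleHead∘toggleLast≡toggleEnds (2 ∷ [])                                 = refl
toggleHead∘toggleLast≡toggleEnds (suc (suc (suc _)) ∷ [])                 = refl
toggleHead∘toggleLast≡toggleEnds (zero ∷ zero ∷ [])                       = refl
toggleHead∘toggleLast≡toggleEnds (zero ∷ 1 ∷ [])                          = refl
toggleHead∘toggleLast≡toggleEnds (zero ∷ suc (suc _) ∷ [])                = refl
toggleHead∘toggleLast≡toggleEnds (1 ∷ zero ∷ [])                          = refl
toggleHead∘toggleLast≡toggleEnds (1 ∷ 1 ∷ [])                             = refl
toggleHead∘toggleLast≡toggleEnds (1 ∷ suc (suc _) ∷ [])                   = refl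
toggleHead∘toggleLast≡toggleEnds (suc (suc _) ∷ zero ∷ [])                = refl
toggleHead∘toggleLast≡toggleEnds (suc (suc _) ∷ 1 ∷ [])                   = refl
toggleHead∘toggleLast≡toggleEnds (suc (suc _) ∷ suc (suc _) ∷ [])         = refl
toggleHead∘toggleLast≡toggleEnds (zero ∷ _ ∷ zero ∷ [])                   = refl
toggleHead∘toggleLast≡toggleEnds (zero ∷ _ ∷ 1 ∷ [])                      = refl
toggleHead∘toggleLast≡toggleEnds (zero ∷ _ ∷ suc (suc _) ∷ [])            = refl
toggleHead∘toggleLast≡toggleEnds (1 ∷ _ ∷ zero ∷ [])                      = refl
toggleHead∘toggleLast≡toggleEnds (1 ∷ _ ∷ 1 ∷ [])                         = refl
toggleHead∘toggleLast≡toggleEnds (1 ∷ _ ∷ suc (suc _) ∷ [])               = refl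
toggleHead∘toggleLast≡toggleEnds (suc (suc _) ∷ _ ∷ zero ∷ [])            = refl
toggleHead∘toggleLast≡toggleEnds (suc (suc _) ∷ _ ∷ 1 ∷ [])               = refl
toggleHead∘toggleLast≡toggleEnds (suc (suc _) ∷ _ ∷ suc (suc _) ∷ [])     = refl

toggleEnds-fixedPointFree : ∀ {σ} → All (0 <_) σ → 3 ≤ sum σ → toggleEnds σ ≢ σ
toggleEnds-fixedPointFree {1 ∷ suc b ∷ c ∷ d ∷ τ}                      _ _ e
  with () ← trans (sym (toggleEnds-apart 1 (suc b) (c ∷ d ∷ τ) (s≤s (s≤s z≤n)))) e
toggleEnds-fixedPointFree {suc (suc a) ∷ b ∷ c ∷ d ∷ τ}                _ _ e
  with () ← trans (sym (toggleEnds-apart (suc (suc a)) b (c ∷ d ∷ τ) (s≤s (s≤s z≤n)))) e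
toggleEnds-fixedPointFree {[]}                                         _ ()
toggleEnds-fixedPointFree {1 ∷ []}                                     _ (s≤s ())
toggleEnds-fixedPointFree {2 ∷ []}                                     _ (s≤s (s≤s ()))
toggleEnds-fixedPointFree {suc (suc (suc _)) ∷ []}                     _ _ ()
toggleEnds-fixedPointFree {1 ∷ 1 ∷ []}                                 _ (s≤s (s≤s ()))
toggleEnds-fixedPointFree {1 ∷ suc (suc _) ∷ []}                       _ _ ()
toggleEnds-fixedPointFree {suc (suc _) ∷ 1 ∷ []}                       _ _ ()
toggleEnds-fixedPointFree {suc (suc _) ∷ suc (suc _) ∷ []}             _ _ ()
toggleEnds-fixedPointFree {1 ∷ suc _ ∷ 1 ∷ []}                         _ _ ()
toggleEnds-fixedPointFree {1 ∷ suc _ ∷ suc (suc _) ∷ []}               _ _ ()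
toggleEnds-fixedPointFree {suc (suc _) ∷ suc _ ∷ 1 ∷ []}               _ _ ()
toggleEnds-fixedPointFree {suc (suc _) ∷ suc _ ∷ suc (suc _) ∷ []}     _ _ ()
toggleEnds-fixedPointFree {zero ∷ _}                                   (() ∷ _)
toggleEnds-fixedPointFree {suc _ ∷ zero ∷ _}                           (_ ∷ () ∷ _)
toggleEnds-fixedPointFree {suc _ ∷ suc _ ∷ zero ∷ _}                   (_ ∷ _ ∷ () ∷ _)

toggleEnds-palindrome : ∀ {σ} → Palindrome σ → Palindrome (toggleEnds σ)
toggleEnds-palindrome {σ} pal = sym (begin
  reverse (reverse (toggleHead (reverse (toggleHead σ))))
    ≡⟨ reverse-involutive (toggleHead (reverse (toggleHead σ))) ⟩
  toggleHead (reverse (toggleHead σ))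
    ≡⟨ cong (toggleHead ∘ reverse ∘ toggleHead) pal ⟩
  toggleHead (toggleLast σ)
    ≡⟨ toggleHead∘toggleLast≡toggleEnds σ ⟩
  toggleEnds σ ∎)
  where open ≡-Reasoning

toggleEnds-involutive : ∀ {σ} → All (0 <_) σ → toggleEnds (toggleEnds σ) ≡ σ
toggleEnds-involutive {σ} pos = begin
  toggleLast (toggleHead (toggleLast (toggleHead σ)))
    ≡⟨ cong toggleLast (toggleHead∘toggleLast≡toggleEnds (toggleHead σ)) ⟩
  toggleLast (toggleLast (toggleHead (toggleHead σ)))
    ≡⟨ cong (toggleLast ∘ toggleLast) (toggleHead-involutive pos) ⟩
  toggleLast (toggleLast σ)
    ≡⟨ toggleLast-involutive pos ⟩
  σ ∎
  where open ≡-Reasoning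

module _ (n m : ℕ) .{{_ : NonZero m}} where

  toggleEnds-fixedPointFreeInvolution : 3 ≤ n →
    FixedPointFreeInvolutionOn ((IsComposition n ∩ PalindromicMod m) ∩ Palindrome) toggleEnds
  toggleEnds-fixedPointFreeInvolution 3≤n = record
    { closed         = λ ((c , _) , pal) →
        (toggleLast-isComposition (toggleHead-isComposition c) ,
         palindrome⇒PalindromicMod m (toggleEnds-palindrome pal)) ,
        toggleEnds-palindrome pal
    ; involutive     = λ (((pos , _) , _) , _) → toggleEnds-involutive pos
    ; fixedPointFree = λ (((pos , sum≡n) , _) , _) →
        toggleEnds-fixedPointFree pos (subst (3 ≤_) (sym sum≡n) 3≤n)
    }

  reverse-fixedPointFreeInvolution :
    FixedPointFreeInvolutionOn ((IsComposition n ∩ PalindromicMod m) ∩ ∁ Palindrome) reverse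
  reverse-fixedPointFreeInvolution = record
    { closed         = λ {σ} ((c , pal-m) , ¬pal) →
        (reverse-isComposition c , PalindromicMod-reverse m {σ} pal-m) ,
        λ pal → ¬pal (sym (trans pal (reverse-involutive σ)))
    ; involutive     = λ {σ} _ → reverse-involutive σ
    ; fixedPointFree = λ (_ , ¬pal) rσ≡σ → ¬pal (sym rσ≡σ)
    }

  palindromicCompositions-unique : Unique (filter (palindromicMod? m) (compositions n))
  palindromicCompositions-unique = Unique.filter⁺ (palindromicMod? m) (compositions-unique n)

  ∈-palindromicCompositions :
    IsComposition n ∩ PalindromicMod m ≐ (_∈ filter (palindromicMod? m) (compositions n))
  ∈-palindromicCompositions =
    (λ (c , pal-m) → ∈-filter⁺ (palindromicMod? m) (∈-compositions c) pal-m) ,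
    (λ σ∈ → let σ∈compositions , pal-m = ∈-filter⁻ (palindromicMod? m) {xs = compositions n} σ∈
            in proj₂ (∈-filter⁻ (isComposition? n) {xs = candidates n} σ∈compositions) , pal-m)

-- compositions 2 evaluates to (2 ∷ []) ∷ (1 ∷ 1 ∷ []) ∷ [].
pc-2 : ∀ m .{{_ : NonZero m}} → pc 2 m ≡ 2
pc-2 m = cong length (filter-all (palindromicMod? m)
  (palindrome⇒PalindromicMod m {2 ∷ []} refl ∷
   palindrome⇒PalindromicMod m {1 ∷ 1 ∷ []} refl ∷ []))

proposition2 : (n m : ℕ) → 1 < n → .{{_ : NonZero m}} → 2 ∣ pc n m
proposition2 1                     m (s≤s ())
proposition2 2                     m _ = ∣-reflexive (sym (pc-2 m))
proposition2 n@(suc (suc (suc _))) m _ =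
  2∣length (palindromicCompositions-unique n m)
    (FixedPointFreeInvolutionOn-resp-≐ (∈-palindromicCompositions n m)
      (piecewise-fixedPointFreeInvolution palindrome? toggleEnds reverse
        (toggleEnds-fixedPointFreeInvolution n m (s≤s (s≤s (s≤s z≤n))))
        (reverse-fixedPointFreeInvolution n m)))
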